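{- Let $G=(\mathcal{A}\cup\mathcal{B},E)$ be a finite bipartite graph with strict preference orders, and let $M_1,M_2$ be stable matchings in $G$ such that for some $a\in\mathcal{A}$ and $b\in\mathcal{B}$, $$M_1\cap\delta^{>a}(b)\neq\varnothing,\qquad M_1\cap\delta^{>b}(a)\neq\varnothing,\qquad M_2\cap\big(\delta^{>a}(b)\cup\delta^{>b}(a)\big)=\varnothing.$$ Then $\chi(M_1)$ and $\chi(M_2)$ are not the endpoints of an edge of the stable matching polytope $P(G)$.
   Context: Each node $u$ has a strict total order $>_u$ on its neighbours together with $\varnothing$ (least preferred). A matching $M$ is stable if for every edge $uv\notin M$, $M(u)>_u v$ or $M(v)>_v u$, where $M(u)$ is $u$'s partner in $M$ or $\varnothing$. For nodes $u,v$ (not necessarily adjacent), $\delta^{>u}(v)=\{vw\in E: w>_v u\}$. $P(G)=\operatorname{conv}\{\chi(M): M\text{ stable matching in }G\}\subseteq\mathbb{R}^E$, where $\chi(M)$ is the incidence vector of $M$.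
   Formalization: The stable matching polytope P(G) is taken in ℚ^E rather than ℝ^E: its points, the convex coefficients and the linear functional exposing an edge are rational. -}

module Defs where

open import Data.Nat as ℕ using (ℕ)
open import Data.Fin using (Fin)
open import Data.Bool using (Bool; true; false; if_then_else_)
open import Data.Product using (Σ; ∃; _×_; _,_; proj₁; proj₂)
open import Data.Sum using (_⊎_)
open import Data.List using (List; foldr; map)
open import Data.List.Relation.Unary.All using (All)
open import Data.Vec.Functional using (Vector)
open import Data.Fin using (Fin)
open import Data.List using (allFin)
open import Data.Rational using (ℚ; 0ℚ; 1ℚ; _+_; _*_; _-_; _≤_)
open import Relation.Binary.PropositionalEquality using (_≡_)
open import Relation.Nullary using (¬_)
open import Function.Definitions using (Injective)

-- A finite bipartite graph G = (A ∪ B, E) with A = Fin m, B = Fin n and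
-- E = Fin k (edges listed without repetition, each with its endpoints),
-- together with strict preference orders.  The strict total order of a
-- node is given by an injective rank function on the whole opposite side
-- (larger rank = more preferred); ∅ is below every node.
-- w >_v u  iff  rank_v u < rank_v w.
record BipGraph : Set where
  field
    m n k  : ℕ
    end    : Fin k → Fin m × Fin n
    end-inj : Injective _≡_ _≡_ end
    rkA    : Fin m → Fin n → ℕ
    rkA-inj : ∀ a → Injective _≡_ _≡_ (rkA a)
    rkB    : Fin n → Fin m → ℕ
    rkB-inj : ∀ b → Injective _≡_ _≡_ (rkB b)

module _ (G : BipGraph) where
  open BipGraph G

  endA : Fin k → Fin m
  endA e = proj₁ (end e)

  endB : Fin k → Fin n
  endB e = proj₂ (end e)

  EdgeSet : Set
  EdgeSet = Fin k → Bool

  IsMatching : EdgeSet → Set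
  IsMatching M = ∀ e f → M e ≡ true → M f ≡ true → ¬ (e ≡ f) →
                 ¬ (endA e ≡ endA f) × ¬ (endB e ≡ endB f)

  BetterA : EdgeSet → Fin m → Fin n → Set
  BetterA M a w = ∃ λ e → M e ≡ true × endA e ≡ a × rkA a w ℕ.< rkA a (endB e)

  BetterB : EdgeSet → Fin n → Fin m → Set
  BetterB M b w = ∃ λ e → M e ≡ true × endB e ≡ b × rkB b w ℕ.< rkB b (endA e)

  IsStable : EdgeSet → Set
  IsStable M = IsMatching M ×
    (∀ e → M e ≡ false → BetterA M (endA e) (endB e) ⊎ BetterB M (endB e) (endA e))

  InδB : Fin m → Fin n → Fin k → Set
  InδB a b e = endB e ≡ b × rkB b a ℕ.< rkB b (endA e)

  InδA : Fin n → Fin m → Fin k → Set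
  InδA b a e = endA e ≡ a × rkA a b ℕ.< rkA a (endB e)

  Point : Set
  Point = Fin k → ℚ

  χ : EdgeSet → Point
  χ M e = if M e then 1ℚ else 0ℚ

  sumℚ : List ℚ → ℚ
  sumℚ = foldr _+_ 0ℚ

  dot : Point → Point → ℚ
  dot c x = sumℚ (map (λ e → c e * x e) (allFin k))

  InP : Point → Set
  InP x = Σ (List (ℚ × EdgeSet)) λ L →
      All (λ p → (0ℚ ≤ proj₁ p) × IsStable (proj₂ p)) L
    × sumℚ (map proj₁ L) ≡ 1ℚ
    × (∀ e → x e ≡ sumℚ (map (λ p → proj₁ p * χ (proj₂ p) e) L))

  IsEdgeOfP : Point → Point → Set
  IsEdgeOfP x y = ¬ (∀ e → x e ≡ y e) × InP x × InP y ×
    Σ Point λ c →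
        (∀ z → InP z → dot c z ≤ dot c x)
      × dot c y ≡ dot c x
      × (∀ z → InP z → dot c z ≡ dot c x →
           Σ ℚ λ t → (0ℚ ≤ t) × (t ≤ 1ℚ) ×
             (∀ e → z e ≡ t * x e + (1ℚ - t) * y e))

-- The A-optimal join J and the B-optimal meet of two stable matchings M₁, M₂ are
-- again stable, and every edge lies in as many of J and the meet as of M₁ and M₂,
-- so χ(J) + χ(meet) = χ(M₁) + χ(M₂).  If [χ(M₁), χ(M₂)] were an edge of P(G) on
-- which a functional c is maximised, both χ(J) and χ(meet) would maximise c, so
-- χ(J) would lie on that segment and could not distinguish two edges on which
-- M₁ and M₂ agree.  The hypotheses provide two such edges, the M₁-edges at b and
-- at a, both outside M₂: in M₂ the A-end of the first trades up, so J drops it,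
-- while a cannot trade up, so J keeps the second.
module Submission where

open import Defs
open import Data.Product using (∃; _×_)
open import Data.Sum using (_⊎_)
open import Data.Bool using (true)
open import Data.Fin using (Fin)
open import Relation.Binary.PropositionalEquality using (_≡_)
open import Relation.Nullary using (¬_)

open import Data.Bool using (Bool; false; if_then_else_)
import Data.Bool.Properties as Boolₚ
open import Data.Empty using (⊥)
import Data.Fin as Fin
import Data.Fin.Properties as Finₚ
open import Data.List using (List; []; _∷_; map; allFin)
open import Data.List.Relation.Unary.All using ([]; _∷_)
import Data.Nat as ℕ
import Data.Nat.Properties as ℕₚ
open import Data.Product using (Σ; _,_; proj₁; proj₂; swap)
open import Data.Rational using (ℚ; 0ℚ; 1ℚ; _+_; _*_; _-_; _≤_)
import Data.Rational.Properties as ℚₚ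
open import Data.Sum using (inj₁; inj₂)
import Data.Sum as Sum
open import Function.Bundles using (mk⇔)
open import Function.Definitions using (Injective)
open import Relation.Binary.Definitions using (tri<; tri≈; tri>)
open import Relation.Binary.PropositionalEquality
  using (_≢_; refl; sym; trans; cong; cong₂; subst; module ≡-Reasoning)
open import Relation.Nullary using (Dec; yes; no; does; contradiction)
open import Relation.Nullary.Decidable
  using (_×-dec_; _⊎-dec_; ¬?; dec-true; dec-false; does-⇔; decidable-stable)
open import Relation.Unary using (Decidable)

open import Algebra.Bundles using (CommutativeMonoid)
open import Algebra.Properties.CommutativeSemigroup
  (CommutativeMonoid.commutativeSemigroup ℚₚ.+-0-commutativeMonoid) using (interchange)

injective⇒onto : ∀ {n} (f : Fin n → Fin n) → Injective _≡_ _≡_ f →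
                 ∀ y → ∃ λ x → f x ≡ y
injective⇒onto {ℕ.suc n} f f-inj y with Finₚ.any? (λ x → f x Finₚ.≟ y)
... | yes found = found
... | no missed = contradiction (Finₚ.injective⇒≤ {f = squeezed} squeezed-inj) ℕₚ.1+n≰n
  where
  y≢f : ∀ x → y ≢ f x
  y≢f x eq = missed (x , sym eq)

  squeezed : Fin (ℕ.suc n) → Fin n
  squeezed x = Fin.punchOut (y≢f x)

  squeezed-inj : Injective _≡_ _≡_ squeezed
  squeezed-inj {x} {z} eq = f-inj (Finₚ.punchOut-injective (y≢f x) (y≢f z) eq)

injectiveOn⇒onto : ∀ {n} {P : Fin n → Set} → Decidable P →
                   (f : ∀ x → P x → Fin n) → (∀ x px → P (f x px)) →
                   (∀ {x y} px py → f x px ≡ f y py → x ≡ y) →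
                   ∀ y → P y → ∃ λ x → Σ (P x) λ px → f x px ≡ y
injectiveOn⇒onto {P = P} P? f f-into f-inj y py =
  let x , gx≡y = injective⇒onto g g-inj y in preimage x (P? x) gx≡y
  where
  extend : ∀ x → Dec (P x) → Fin _
  extend x (yes px) = f x px
  extend x (no _)   = x

  g : Fin _ → Fin _
  g x = extend x (P? x)

  extend-inj : ∀ {x z} (dx : Dec (P x)) (dz : Dec (P z)) →
               extend x dx ≡ extend z dz → x ≡ z
  extend-inj (yes px) (yes pz) eq   = f-inj px pz eq
  extend-inj (yes px) (no ¬pz) refl = contradiction (f-into _ px) ¬pz
  extend-inj (no ¬px) (yes pz) refl = contradiction (f-into _ pz) ¬px
  extend-inj (no _)   (no _)   eq   = eq

  g-inj : Injective _≡_ _≡_ g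
  g-inj {x} {z} = extend-inj (P? x) (P? z)

  preimage : ∀ x (dx : Dec (P x)) → extend x dx ≡ y →
             ∃ λ x → Σ (P x) λ px → f x px ≡ y
  preimage x (yes px) eq   = x , px , eq
  preimage x (no ¬px) refl = contradiction py ¬px

injective⇒<⊎> : ∀ {A : Set} {f : A → ℕ.ℕ} → Injective _≡_ _≡_ f →
                ∀ {x y} → x ≢ y → f x ℕ.< f y ⊎ f y ℕ.< f x
injective⇒<⊎> {f = f} f-inj {x} {y} x≢y with ℕₚ.<-cmp (f x) (f y)
... | tri< lt _ _ = inj₁ lt
... | tri≈ _ eq _ = contradiction (f-inj eq) x≢y
... | tri> _ _ gt = inj₂ gt

≢true⇒≡false : ∀ {x} → x ≢ true → x ≡ false
≢true⇒≡false = Boolₚ.¬-not {y = true}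

does⇒witness : ∀ {P : Set} (d : Dec P) → does d ≡ true → P
does⇒witness (yes p) _ = p

module Matchings (G : BipGraph) where
  open BipGraph G

  ≡-fromEnds : ∀ {e f} → endA G e ≡ endA G f → endB G e ≡ endB G f → e ≡ f
  ≡-fromEnds p q = end-inj (cong₂ _,_ p q)

  module _ {M : EdgeSet G} (matching : IsMatching G M)
           {e f : Fin k} (e∈M : M e ≡ true) (f∈M : M f ≡ true) where

    sameA⇒≡ : endA G e ≡ endA G f → e ≡ f
    sameA⇒≡ eq = decidable-stable (e Finₚ.≟ f)
      (λ e≢f → proj₁ (matching e f e∈M f∈M e≢f) eq)

    sameB⇒≡ : endB G e ≡ endB G f → e ≡ f
    sameB⇒≡ eq = decidable-stable (e Finₚ.≟ f)
      (λ e≢f → proj₂ (matching e f e∈M f∈M e≢f) eq)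

  BetterA? : (M : EdgeSet G) → ∀ a w → Dec (BetterA G M a w)
  BetterA? M a w = Finₚ.any? λ e →
    (M e Boolₚ.≟ true) ×-dec (endA G e Finₚ.≟ a) ×-dec (rkA a w ℕₚ.<? rkA a (endB G e))

  module _ {M : EdgeSet G} (matching : IsMatching G M) {f : Fin k} (f∈M : M f ≡ true) where

    BetterA⇒rank< : ∀ {a w} → endA G f ≡ a → BetterA G M a w → rkA a w ℕ.< rkA a (endB G f)
    BetterA⇒rank< refl (g , g∈M , g-a , w<g) with refl ← sameA⇒≡ matching g∈M f∈M g-a = w<g

    BetterB⇒rank< : ∀ {b w} → endB G f ≡ b → BetterB G M b w → rkB b w ℕ.< rkB b (endA G f)
    BetterB⇒rank< refl (g , g∈M , g-b , w<g) with refl ← sameB⇒≡ matching g∈M f∈M g-b = w<g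

    ¬BetterA-self : ¬ BetterA G M (endA G f) (endB G f)
    ¬BetterA-self better = ℕₚ.<-irrefl refl (BetterA⇒rank< refl better)

  module _ {M : EdgeSet G} (stable : IsStable G M) {e : Fin k} (e∉M : M e ≡ false) where

    stable⇒BetterB : ¬ BetterA G M (endA G e) (endB G e) → BetterB G M (endB G e) (endA G e)
    stable⇒BetterB ¬better = Sum.[ (λ better → contradiction better ¬better) , (λ b → b) ]
      (proj₂ stable e e∉M)

    stable⇒BetterA : ¬ BetterB G M (endB G e) (endA G e) → BetterA G M (endA G e) (endB G e)
    stable⇒BetterA ¬better = Sum.[ (λ a → a) , (λ better → contradiction better ¬better) ]
      (proj₂ stable e e∉M)

  -- Each a that improves in M' is sent to the M-partner
  -- of M'(a), which improves as well; this map is injective, hence onto the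
  -- improving vertices, and the preimage of endA f is M'(endB f), whom endB f
  -- likes less than endA f.
  module Opposition {M M' : EdgeSet G} (stable : IsStable G M) (stable' : IsStable G M') where

    Improves : Fin m → Set
    Improves a = ∃ λ f → M f ≡ true × endA G f ≡ a × BetterA G M' a (endB G f)

    Improves? : Decidable Improves
    Improves? a = Finₚ.any? λ f →
      (M f Boolₚ.≟ true) ×-dec (endA G f Finₚ.≟ a) ×-dec BetterA? M' a (endB G f)

    record Rival (a : Fin m) : Set where
      field
        edge         : Fin k
        edge∈M       : M edge ≡ true
        improves     : Improves (endA G edge)
        partner      : Fin k
        partner∈M'   : M' partner ≡ true
        partner-a    : endA G partner ≡ a
        partner-b    : endB G partner ≡ endB G edge
        preferred    : rkB (endB G edge) a ℕ.< rkB (endB G edge) (endA G edge)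

    rival : ∀ {a} → Improves a → Rival a
    rival (f , f∈M , f-a , g , g∈M' , refl , f<g) = record
      { edge = h ; edge∈M = h∈M ; improves = h , h∈M , refl , h-improves
      ; partner = g ; partner∈M' = g∈M' ; partner-a = refl ; partner-b = sym h-b
      ; preferred = subst (λ b → rkB b (endA G g) ℕ.< rkB b (endA G h)) (sym h-b) g<h }
      where
      g∉M : M g ≡ false
      g∉M = ≢true⇒≡false λ g∈M → ℕₚ.<-irrefl
        (cong (λ x → rkA (endA G g) (endB G x)) (sameA⇒≡ (proj₁ stable) f∈M g∈M f-a)) f<g

      b-prefers-M : BetterB G M (endB G g) (endA G g)
      b-prefers-M = stable⇒BetterB stable g∉M λ better →
        ℕₚ.<-asym f<g (BetterA⇒rank< (proj₁ stable) f∈M f-a better)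

      h = proj₁ b-prefers-M
      h∈M = proj₁ (proj₂ b-prefers-M)
      h-b = proj₁ (proj₂ (proj₂ b-prefers-M))
      g<h = proj₂ (proj₂ (proj₂ b-prefers-M))

      h∉M' : M' h ≡ false
      h∉M' = ≢true⇒≡false λ h∈M' → ℕₚ.<-irrefl
        (cong (λ x → rkB (endB G g) (endA G x)) (sym (sameB⇒≡ (proj₁ stable') h∈M' g∈M' h-b))) g<h

      h-improves : BetterA G M' (endA G h) (endB G h)
      h-improves = stable⇒BetterA stable' h∉M' λ better →
        ℕₚ.<-asym g<h (subst (λ b → rkB b (endA G h) ℕ.< rkB b (endA G g)) h-b
          (BetterB⇒rank< (proj₁ stable') g∈M' (sym h-b) better))

    rival-end : ∀ a → Improves a → Fin m
    rival-end a i = endA G (Rival.edge (rival i))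

    rival-end-inj : ∀ {a a'} (i : Improves a) (i' : Improves a') →
                    rival-end a i ≡ rival-end a' i' → a ≡ a'
    rival-end-inj i i' eq = begin
      _                ≡⟨ sym (R.partner-a) ⟩
      endA G R.partner  ≡⟨ cong (endA G) partner≡ ⟩
      endA G R'.partner ≡⟨ R'.partner-a ⟩
      _                ∎
      where
      open ≡-Reasoning
      module R  = Rival (rival i)
      module R' = Rival (rival i')
      edge≡ : R.edge ≡ R'.edge
      edge≡ = sameA⇒≡ (proj₁ stable) R.edge∈M R'.edge∈M eq
      partner≡ : R.partner ≡ R'.partner
      partner≡ = sameB⇒≡ (proj₁ stable') R.partner∈M' R'.partner∈M'
        (trans R.partner-b (trans (cong (endB G) edge≡) (sym R'.partner-b)))

    rival-edge-¬BetterB : ∀ {x f} (r : Rival x) → Rival.edge r ≡ f →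
                          ¬ BetterB G M' (endB G f) (endA G f)
    rival-edge-¬BetterB record { partner = p ; partner∈M' = p∈M' ; partner-a = refl
                               ; partner-b = p-b ; preferred = x<f }
                        refl (g , g∈M' , g-b , f<g)
      with refl ← sameB⇒≡ (proj₁ stable') p∈M' g∈M' (trans p-b (sym g-b))
      = ℕₚ.<-asym f<g x<f

    opposition : ∀ {f} → M f ≡ true → BetterA G M' (endA G f) (endB G f) →
                 ¬ BetterB G M' (endB G f) (endA G f)
    opposition {f} f∈M f-improves =
      let x , ix , rx≡f = injectiveOn⇒onto Improves? rival-end (λ _ i → Rival.improves (rival i))
                            rival-end-inj (endA G f) (f , f∈M , refl , f-improves)
      in rival-edge-¬BetterB (rival ix) (sameA⇒≡ (proj₁ stable) (Rival.edge∈M (rival ix)) f∈M rx≡f)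

  InJoin : EdgeSet G → EdgeSet G → Fin k → Set
  InJoin M M' e = (M e ≡ true × ¬ BetterA G M' (endA G e) (endB G e))
                ⊎ (M' e ≡ true × ¬ BetterA G M (endA G e) (endB G e))

  InJoin? : ∀ M M' → Decidable (InJoin M M')
  InJoin? M M' e = ((M e Boolₚ.≟ true) ×-dec ¬? (BetterA? M' (endA G e) (endB G e)))
            ⊎-dec ((M' e Boolₚ.≟ true) ×-dec ¬? (BetterA? M (endA G e) (endB G e)))

  join : EdgeSet G → EdgeSet G → EdgeSet G
  join M M' e = does (InJoin? M M' e)

  join-comm : ∀ M M' e → join M M' e ≡ join M' M e
  join-comm M M' e = does-⇔ (mk⇔ Sum.swap Sum.swap) (InJoin? M M' e) (InJoin? M' M e)

  module _ {M M' : EdgeSet G} {e : Fin k} where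

    ∈join⁺ : InJoin M M' e → join M M' e ≡ true
    ∈join⁺ = dec-true (InJoin? M M' e)

    ∈join⁻ : join M M' e ≡ true → InJoin M M' e
    ∈join⁻ = does⇒witness (InJoin? M M' e)

    ∉join : ¬ InJoin M M' e → join M M' e ≡ false
    ∉join = dec-false (InJoin? M M' e)

    ∈join-of-∈ : IsMatching G M' → M e ≡ true → M' e ≡ true → join M M' e ≡ true
    ∈join-of-∈ matching' e∈M e∈M' = ∈join⁺ (inj₁ (e∈M , ¬BetterA-self matching' e∈M'))

    ∉join-of-∉ : M e ≡ false → M' e ≡ false → join M M' e ≡ false
    ∉join-of-∉ e∉M e∉M' = ∉join Sum.[ (λ (e∈M , _) → Boolₚ.not-¬ e∈M e∉M)
                                    , (λ (e∈M' , _) → Boolₚ.not-¬ e∈M' e∉M') ]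

  module _ {M M' : EdgeSet G} (stable : IsStable G M) (stable' : IsStable G M') where

    crossing-disjoint : ∀ {e f} → M e ≡ true → ¬ BetterA G M' (endA G e) (endB G e) →
                        M' f ≡ true → ¬ BetterA G M (endA G f) (endB G f) → e ≢ f →
                        ¬ (endA G e ≡ endA G f) × ¬ (endB G e ≡ endB G f)
    crossing-disjoint {e} {f} e∈M e-stays f∈M' f-stays e≢f = sameA⇒⊥ , sameB⇒⊥
      where
      sameA⇒⊥ : ¬ (endA G e ≡ endA G f)
      sameA⇒⊥ eqA with injective⇒<⊎> (rkA-inj (endA G e)) (λ eqB → e≢f (≡-fromEnds eqA eqB))
      ... | inj₁ e<f = e-stays (f , f∈M' , sym eqA , e<f)
      ... | inj₂ f<e = f-stays (e , e∈M , eqA ,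
                                subst (λ a → rkA a (endB G f) ℕ.< rkA a (endB G e)) eqA f<e)

      sameB⇒⊥ : ¬ (endB G e ≡ endB G f)
      sameB⇒⊥ eqB = ℕₚ.<-asym (subst (λ b → rkB b (endA G e) ℕ.< rkB b (endA G f)) eqB e<f) f<e
        where
        e∉M' : M' e ≡ false
        e∉M' = ≢true⇒≡false λ e∈M' → e≢f (sameB⇒≡ (proj₁ stable') e∈M' f∈M' eqB)
        f∉M : M f ≡ false
        f∉M = ≢true⇒≡false λ f∈M → e≢f (sameB⇒≡ (proj₁ stable) e∈M f∈M eqB)
        e<f : rkB (endB G e) (endA G e) ℕ.< rkB (endB G e) (endA G f)
        e<f = BetterB⇒rank< (proj₁ stable') f∈M' (sym eqB) (stable⇒BetterB stable' e∉M' e-stays)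
        f<e : rkB (endB G f) (endA G f) ℕ.< rkB (endB G f) (endA G e)
        f<e = BetterB⇒rank< (proj₁ stable) e∈M eqB (stable⇒BetterB stable f∉M f-stays)

    join-dominatesˡ : ∀ {f a w} → M f ≡ true → endA G f ≡ a → rkA a w ℕ.< rkA a (endB G f) →
                      BetterA G (join M M') a w
    join-dominatesˡ {f} f∈M refl w<f with BetterA? M' (endA G f) (endB G f)
    ... | no f-stays = f , ∈join⁺ (inj₁ (f∈M , f-stays)) , refl , w<f
    ... | yes (g , g∈M' , g-a , f<g) =
      g , ∈join⁺ (inj₂ (g∈M' , g-stays)) , g-a , ℕₚ.<-trans w<f f<g
      where
      g-stays : ¬ BetterA G M (endA G g) (endB G g)
      g-stays better = ℕₚ.<-asym f<g (subst (λ a → rkA a (endB G g) ℕ.< rkA a (endB G f)) g-a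
        (BetterA⇒rank< (proj₁ stable) f∈M (sym g-a) better))

    ¬improves-both : ∀ {f f'} → M f ≡ true → M' f' ≡ true → endB G f ≡ endB G f' →
                     BetterA G M' (endA G f) (endB G f) → BetterA G M (endA G f') (endB G f') → ⊥
    ¬improves-both {f} {f'} f∈M f'∈M' eqB f-improves f'-improves with endA G f Finₚ.≟ endA G f'
    ... | yes eqA with refl ← ≡-fromEnds eqA eqB = ¬BetterA-self (proj₁ stable') f'∈M' f-improves
    ... | no neA with injective⇒<⊎> (rkB-inj (endB G f)) neA
    ...   | inj₁ f<f' = Opposition.opposition stable stable' f∈M f-improves
                          (f' , f'∈M' , sym eqB , f<f')
    ...   | inj₂ f'<f = Opposition.opposition stable' stable f'∈M' f'-improves
                          (f , f∈M , eqB , subst (λ b → rkB b (endA G f') ℕ.< rkB b (endA G f)) eqB f'<f)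

    join-coversB : ∀ {f f'} → M f ≡ true → M' f' ≡ true → endB G f ≡ endB G f' →
                   join M M' f ≡ true ⊎ join M M' f' ≡ true
    join-coversB {f} {f'} f∈M f'∈M' eqB =
      cover (BetterA? M' (endA G f) (endB G f)) (BetterA? M (endA G f') (endB G f'))
      where
      cover : Dec (BetterA G M' (endA G f) (endB G f)) → Dec (BetterA G M (endA G f') (endB G f')) →
              join M M' f ≡ true ⊎ join M M' f' ≡ true
      cover (no f-stays)     _                = inj₁ (∈join⁺ (inj₁ (f∈M , f-stays)))
      cover (yes _)          (no f'-stays)    = inj₂ (∈join⁺ (inj₂ (f'∈M' , f'-stays)))
      cover (yes f-improves) (yes f'-improves) =
        contradiction f'-improves (¬improves-both f∈M f'∈M' eqB f-improves)

  join-dominatesʳ : ∀ {M M'} → IsStable G M → IsStable G M' → ∀ {f a w} →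
                    M' f ≡ true → endA G f ≡ a → rkA a w ℕ.< rkA a (endB G f) →
                    BetterA G (join M M') a w
  join-dominatesʳ {M} {M'} stable stable' f∈M' f-a w<f =
    let g , g∈J , rest = join-dominatesˡ stable' stable f∈M' f-a w<f
    in g , trans (join-comm M M' g) g∈J , rest

  join-isStable : ∀ {M M'} → IsStable G M → IsStable G M' → IsStable G (join M M')
  join-isStable {M} {M'} stable stable' = matching , blocked
    where
    matching : IsMatching G (join M M')
    matching e f e∈J f∈J e≢f with ∈join⁻ e∈J | ∈join⁻ f∈J
    ... | inj₁ (e∈M , _) | inj₁ (f∈M , _) = proj₁ stable e f e∈M f∈M e≢f
    ... | inj₂ (e∈M' , _) | inj₂ (f∈M' , _) = proj₁ stable' e f e∈M' f∈M' e≢f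
    ... | inj₁ (e∈M , e-stays) | inj₂ (f∈M' , f-stays) =
      crossing-disjoint stable stable' e∈M e-stays f∈M' f-stays e≢f
    ... | inj₂ (e∈M' , e-stays) | inj₁ (f∈M , f-stays) =
      crossing-disjoint stable' stable e∈M' e-stays f∈M f-stays e≢f

    blocked : ∀ e → join M M' e ≡ false →
              BetterA G (join M M') (endA G e) (endB G e) ⊎ BetterB G (join M M') (endB G e) (endA G e)
    blocked e e∉J = block (BetterA? M (endA G e) (endB G e)) (BetterA? M' (endA G e) (endB G e))
      where
      ∉-of-∉join : ∀ {x} → (x ≡ true → join M M' e ≡ true) → x ≡ false
      ∉-of-∉join e∈J = ≢true⇒≡false λ x≡true → Boolₚ.not-¬ (e∈J x≡true) e∉J

      block : Dec (BetterA G M (endA G e) (endB G e)) → Dec (BetterA G M' (endA G e) (endB G e)) →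
              BetterA G (join M M') (endA G e) (endB G e) ⊎ BetterB G (join M M') (endB G e) (endA G e)
      block (yes (f , f∈M , f-a , e<f)) _ = inj₁ (join-dominatesˡ stable stable' f∈M f-a e<f)
      block (no _) (yes (f , f∈M' , f-a , e<f)) = inj₁ (join-dominatesʳ stable stable' f∈M' f-a e<f)
      block (no e-stays) (no e-stays') =
        let f  , f∈M   , f-b  , e<f  = stable⇒BetterB stable
                                         (∉-of-∉join λ e∈M → ∈join⁺ (inj₁ (e∈M , e-stays'))) e-stays
            f' , f'∈M' , f'-b , e<f' = stable⇒BetterB stable'
                                         (∉-of-∉join λ e∈M' → ∈join⁺ (inj₂ (e∈M' , e-stays))) e-stays'
        in inj₂ (Sum.[ (λ f∈J → f , f∈J , f-b , e<f) , (λ f'∈J → f' , f'∈J , f'-b , e<f') ]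
                      (join-coversB stable stable' f∈M f'∈M' (trans f-b (sym f'-b))))

transpose : BipGraph → BipGraph
transpose G = record
  { m = n ; n = m ; k = k
  ; end = λ e → swap (end e) ; end-inj = λ eq → end-inj (cong swap eq)
  ; rkA = rkB ; rkA-inj = rkB-inj ; rkB = rkA ; rkB-inj = rkA-inj }
  where open BipGraph G

transpose-stable : ∀ {G M} → IsStable G M → IsStable (transpose G) M
transpose-stable (matching , blocked) =
  (λ e f e∈M f∈M e≢f → swap (matching e f e∈M f∈M e≢f)) , (λ e e∉M → Sum.swap (blocked e e∉M))

transpose-stable⁻ : ∀ {G M} → IsStable (transpose G) M → IsStable G M
transpose-stable⁻ (matching , blocked) =
  (λ e f e∈M f∈M e≢f → swap (matching e f e∈M f∈M e≢f)) , (λ e e∉M → Sum.swap (blocked e e∉M))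

meet : (G : BipGraph) → EdgeSet G → EdgeSet G → EdgeSet G
meet G = Matchings.join (transpose G)

meet-isStable : ∀ {G M M'} → IsStable G M → IsStable G M' → IsStable G (meet G M M')
meet-isStable {G} stable stable' = transpose-stable⁻ {G}
  (Matchings.join-isStable (transpose G) (transpose-stable {G} stable) (transpose-stable {G} stable'))

indicator : Bool → ℚ
indicator b = if b then 1ℚ else 0ℚ

module _ {G : BipGraph} where
  open Matchings G
  private module T = Matchings (transpose G)

  join-meet-split : ∀ {M M'} → IsStable G M → IsStable G M' → ∀ {e} → M e ≡ true → M' e ≡ false →
                    (join M M' e ≡ true × meet G M M' e ≡ false)
                  ⊎ (join M M' e ≡ false × meet G M M' e ≡ true)
  join-meet-split {M} {M'} stable stable' {e} e∈M e∉M' = split (BetterA? M' (endA G e) (endB G e))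
    where
    ¬M'-side : ∀ {P : Set} → ¬ (M' e ≡ true × P)
    ¬M'-side (e∈M' , _) = Boolₚ.not-¬ e∈M' e∉M'

    split : Dec (BetterA G M' (endA G e) (endB G e)) →
            (join M M' e ≡ true × meet G M M' e ≡ false) ⊎ (join M M' e ≡ false × meet G M M' e ≡ true)
    split (yes e-improves) = inj₂
      ( ∉join Sum.[ (λ (_ , e-stays) → e-stays e-improves) , ¬M'-side ]
      , T.∈join⁺ (inj₁ (e∈M , Opposition.opposition stable stable' e∈M e-improves)) )
    split (no e-stays) = inj₁
      ( ∈join⁺ (inj₁ (e∈M , e-stays))
      , T.∉join Sum.[ (λ (_ , b-stays) → b-stays (stable⇒BetterB stable' e∉M' e-stays)) , ¬M'-side ] )

  join-meet-permutes : ∀ {M M'} → IsStable G M → IsStable G M' →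
                       ∀ e → (join M M' e ≡ M e × meet G M M' e ≡ M' e)
                           ⊎ (join M M' e ≡ M' e × meet G M M' e ≡ M e)
  join-meet-permutes {M} {M'} stable stable' e = permute (M e) (M' e) refl refl
    where
    commute : ∀ {x y} → join M' M e ≡ x × meet G M' M e ≡ y → join M M' e ≡ x × meet G M M' e ≡ y
    commute (j , t) = trans (join-comm M M' e) j , trans (T.join-comm M M' e) t

    permute : ∀ x y → M e ≡ x → M' e ≡ y →
              (join M M' e ≡ x × meet G M M' e ≡ y) ⊎ (join M M' e ≡ y × meet G M M' e ≡ x)
    permute true  true  e∈M e∈M' =
      inj₁ ( ∈join-of-∈ {M} {M'} {e} (proj₁ stable') e∈M e∈M'
           , T.∈join-of-∈ {M} {M'} {e} (proj₁ (transpose-stable {G} stable')) e∈M e∈M' )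
    permute false false e∉M e∉M' =
      inj₁ (∉join-of-∉ {M} {M'} {e} e∉M e∉M' , T.∉join-of-∉ {M} {M'} {e} e∉M e∉M')
    permute true  false e∈M e∉M' = join-meet-split stable stable' e∈M e∉M'
    permute false true  e∉M e∈M' =
      Sum.swap (Sum.map commute commute (join-meet-split stable' stable e∈M' e∉M))

  χ-join+meet : ∀ {M M'} → IsStable G M → IsStable G M' →
                ∀ e → χ G (join M M') e + χ G (meet G M M') e ≡ χ G M e + χ G M' e
  χ-join+meet {M} {M'} stable stable' e with join-meet-permutes stable stable' e
  ... | inj₁ (j , t) = cong₂ (λ x y → indicator x + indicator y) j t
  ... | inj₂ (j , t) = trans (cong₂ (λ x y → indicator x + indicator y) j t) (ℚₚ.+-comm (χ G M' e) (χ G M e))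

χ-inP : ∀ G {M} → IsStable G M → InP G (χ G M)
χ-inP G stable = ((1ℚ , _) ∷ []) , ((ℚₚ.nonNegative⁻¹ 1ℚ , stable) ∷ []) , ℚₚ.+-identityʳ 1ℚ ,
  λ e → sym (trans (ℚₚ.+-identityʳ _) (ℚₚ.*-identityˡ _))

dot-cong-+ : ∀ G (c : Point G) {x y z w : Point G} → (∀ e → x e + y e ≡ z e + w e) →
             dot G c x + dot G c y ≡ dot G c z + dot G c w
dot-cong-+ G c {x} {y} {z} {w} x+y≡z+w = go (allFin _)
  where
  open ≡-Reasoning

  S : Point G → List (Fin (BipGraph.k G)) → ℚ
  S v es = sumℚ G (map (λ e → c e * v e) es)

  go : ∀ es → S x es + S y es ≡ S z es + S w es
  go [] = refl
  go (e ∷ es) = begin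
    (c e * x e + S x es) + (c e * y e + S y es) ≡⟨ interchange (c e * x e) (S x es) (c e * y e) (S y es) ⟩
    (c e * x e + c e * y e) + (S x es + S y es) ≡⟨ cong₂ _+_ (sym (ℚₚ.*-distribˡ-+ (c e) (x e) (y e))) (go es) ⟩
    c e * (x e + y e) + (S z es + S w es)       ≡⟨ cong (λ v → c e * v + (S z es + S w es)) (x+y≡z+w e) ⟩
    c e * (z e + w e) + (S z es + S w es)       ≡⟨ cong (_+ (S z es + S w es)) (ℚₚ.*-distribˡ-+ (c e) (z e) (w e)) ⟩
    (c e * z e + c e * w e) + (S z es + S w es) ≡⟨ interchange (c e * z e) (c e * w e) (S z es) (S w es) ⟩
    (c e * z e + S z es) + (c e * w e + S w es) ∎

+-tight⇒≡ˡ : ∀ {p q r} → p ≤ r → q ≤ r → p + q ≡ r + r → p ≡ r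
+-tight⇒≡ˡ p≤r q≤r p+q≡r+r = ℚₚ.≤-antisym p≤r
  (ℚₚ.≮⇒≥ λ p<r → ℚₚ.<-irrefl p+q≡r+r (ℚₚ.+-mono-<-≤ p<r q≤r))

InSegment : ∀ G → Point G → Point G → Point G → Set
InSegment G x y z = Σ ℚ λ t → (0ℚ ≤ t) × (t ≤ 1ℚ) × (∀ e → z e ≡ t * x e + (1ℚ - t) * y e)

InSegment-respects-≡ : ∀ {G x y z e f} → InSegment G x y z → x e ≡ x f → y e ≡ y f → z e ≡ z f
InSegment-respects-≡ {e = e} {f} (t , _ , _ , on-segment) xe≡xf ye≡yf = begin
  _                                 ≡⟨ on-segment e ⟩
  t * _ + (1ℚ - t) * _              ≡⟨ cong₂ (λ u v → t * u + (1ℚ - t) * v) xe≡xf ye≡yf ⟩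
  t * _ + (1ℚ - t) * _              ≡⟨ sym (on-segment f) ⟩
  _                                 ∎
  where open ≡-Reasoning

edge-contains-summand : ∀ {G x y z w} → IsEdgeOfP G x y → InP G z → InP G w →
                        (∀ e → z e + w e ≡ x e + y e) → InSegment G x y z
edge-contains-summand {G} {x} (_ , _ , _ , c , maximal , y-maximal , face) z∈P w∈P z+w≡x+y =
  face _ z∈P (+-tight⇒≡ˡ (maximal _ z∈P) (maximal _ w∈P)
    (trans (dot-cong-+ G c z+w≡x+y) (cong (dot G c x +_) y-maximal)))

corollary1 : (G : BipGraph) (M₁ M₂ : EdgeSet G) →
    IsStable G M₁ → IsStable G M₂ →
    (a : Fin (BipGraph.m G)) (b : Fin (BipGraph.n G)) →
    (∃ λ e → M₁ e ≡ true × InδB G a b e) →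
    (∃ λ e → M₁ e ≡ true × InδA G b a e) →
    (∀ e → M₂ e ≡ true → ¬ (InδB G a b e ⊎ InδA G b a e)) →
    ¬ IsEdgeOfP G (χ G M₁) (χ G M₂)
corollary1 G M₁ M₂ stable₁ stable₂ .(endA G e₂) .(endB G e₁)
           (e₁ , e₁∈M₁ , refl , a<e₁) (e₂ , e₂∈M₁ , refl , b<e₂) M₂-avoids edge =
  ℚₚ.1≢0 (begin
    1ℚ                     ≡⟨ cong indicator (sym e₂∈J) ⟩
    χ G (join M₁ M₂) e₂    ≡⟨ InSegment-respects-≡ {G} J-on-edge
                                (cong indicator (trans e₂∈M₁ (sym e₁∈M₁)))
                                (cong indicator (trans e₂∉M₂ (sym e₁∉M₂))) ⟩
    χ G (join M₁ M₂) e₁    ≡⟨ cong indicator e₁∉J ⟩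
    0ℚ                     ∎)
  where
  open ≡-Reasoning
  open Matchings G

  e₁∉M₂ : M₂ e₁ ≡ false
  e₁∉M₂ = ≢true⇒≡false λ e₁∈M₂ → M₂-avoids e₁ e₁∈M₂ (inj₁ (refl , a<e₁))

  e₂∉M₂ : M₂ e₂ ≡ false
  e₂∉M₂ = ≢true⇒≡false λ e₂∈M₂ → M₂-avoids e₂ e₂∈M₂ (inj₂ (refl , b<e₂))

  e₂∈J : join M₁ M₂ e₂ ≡ true
  e₂∈J = ∈join⁺ (inj₁ (e₂∈M₁ , λ (g , g∈M₂ , g-a , e₂<g) →
    M₂-avoids g g∈M₂ (inj₂ (g-a , ℕₚ.<-trans b<e₂ e₂<g))))

  e₁∉J : join M₁ M₂ e₁ ≡ false
  e₁∉J = ∉join Sum.[ (λ (_ , e₁-stays) → e₁-stays e₁-improves) , (λ (e₁∈M₂ , _) → Boolₚ.not-¬ e₁∈M₂ e₁∉M₂) ]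
    where
    e₁-improves : BetterA G M₂ (endA G e₁) (endB G e₁)
    e₁-improves = stable⇒BetterA stable₂ e₁∉M₂ λ (g , g∈M₂ , g-b , e₁<g) →
      M₂-avoids g g∈M₂ (inj₁ (g-b , ℕₚ.<-trans a<e₁ e₁<g))

  J-on-edge : InSegment G (χ G M₁) (χ G M₂) (χ G (join M₁ M₂))
  J-on-edge = edge-contains-summand {G} edge (χ-inP G (join-isStable stable₁ stable₂))
    (χ-inP G (meet-isStable {G} stable₁ stable₂)) (χ-join+meet {G} stable₁ stable₂)
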